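{- For every integer $r>0$ and every graph $G$ with clique number $\omega(G)$, \[ w_{2r}(G)\ \le\ \frac{\omega(G)-1}{\omega(G)}\, w_r^2(G). \]
   Context: All graphs are finite and simple. A $k$-walk is a sequence of vertices $v_1,\dots,v_k$ with $v_i$ adjacent to $v_{i+1}$ for $i=1,\dots,k-1$; $w_k(G)$ denotes the number of $k$-walks in $G$. $\omega(G)$ is the clique number. -}

module Defs where

open import Data.Nat using (ℕ; zero; suc; _+_)
open import Data.Bool using (Bool; true; false; if_then_else_)
open import Data.Fin using (Fin; zero; suc)
open import Data.Fin.Subset using (Subset; _∈_; ∣_∣)
open import Data.Product using (Σ; _×_)
open import Relation.Binary.PropositionalEquality using (_≡_; _≢_)

record Graph : Set where
  field
    n      : ℕ
    adj    : Fin n → Fin n → Bool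
    sym    : ∀ u v → adj u v ≡ adj v u
    irrefl : ∀ v → adj v v ≡ false
open Graph public

finSum : ∀ {m} → (Fin m → ℕ) → ℕ
finSum {zero}  f = 0
finSum {suc m} f = f zero + finSum (λ i → f (suc i))

-- walksEnd G k v = number of k-walks v_1,…,v_k (k ≥ 1) with v_k = v.
walksEnd : (G : Graph) → ℕ → Fin (n G) → ℕ
walksEnd G zero          v = 0
walksEnd G (suc zero)    v = 1
walksEnd G (suc (suc k)) v =
  finSum (λ u → if adj G u v then walksEnd G (suc k) u else 0)

-- w k G = number of k-walks in G (sequences of k vertices, consecutive
-- ones adjacent).  The unique empty sequence counts as the one 0-walk.
w : ℕ → Graph → ℕ
w zero    G = 1
w (suc k) G = finSum (walksEnd G (suc k))

IsClique : (G : Graph) → Subset (n G) → Set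
IsClique G S = ∀ u v → u ∈ S → v ∈ S → u ≢ v → adj G u v ≡ true

IsCliqueNumber : Graph → ℕ → Set
IsCliqueNumber G ω =
  Σ (Subset (n G)) (λ S → IsClique G S × ∣ S ∣ ≡ ω)
  × (∀ S → IsClique G S → ∣ S ∣ Data.Nat.≤ ω)

-- With A the adjacency matrix and W k the vector counting the k-edge walks ending at each
-- vertex, W (k + 1) = A (W k); hence w (k + 1) = Σ W k and, A being symmetric,
-- w (2 r) = ⟨W, A W⟩ for W = W (r − 1).  The theorem is thus the Motzkin–Straus inequality
-- ω ⟨x, A x⟩ ≤ (ω − 1) (Σ x)² for x ∈ ℕⁿ.  If two vertices u, v in the support of x are not
-- adjacent, moving all of x v onto u, where (A x) u ≥ (A x) v, keeps Σ x, does not decrease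
-- ⟨x, A x⟩ and shrinks the support; so we may assume the support is a clique, of size at most ω.
-- Then ⟨x, A x⟩ + ⟨x, x⟩ ≤ (Σ x)², while Cauchy–Schwarz gives (Σ x)² ≤ |supp x| ⟨x, x⟩ ≤ ω ⟨x, x⟩.

module Submission where

open import Defs hiding (sym)
open import Data.Nat using (ℕ; zero; suc; _+_; _*_; _∸_; _^_; _≤_; _>_; z≤n; _<ᵇ_)
open import Data.Nat.Properties
  using ( +-suc; +-identityʳ; *-identityˡ; *-identityʳ; *-zeroʳ; *-comm; *-assoc
        ; *-distribˡ-+; *-distribʳ-+; *-distribʳ-∸; +-cancelʳ-≡; +-cancelʳ-≤; *-cancelˡ-≤
        ; ≤-refl; ≤-trans; ≤-total; +-mono-≤; +-monoˡ-≤; +-monoʳ-≤; *-monoˡ-≤; *-monoʳ-≤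
        ; m+n≤o⇒m≤o∸n; +-*-semiring; *-commutativeSemigroup; module ≤-Reasoning )
open import Data.Nat.Tactic.RingSolver using (solve-∀)
open import Data.Bool using (Bool; true; false; if_then_else_)
import Data.Bool.Properties as Bool
open import Data.Fin using (Fin; zero; suc; _≟_)
open import Data.Fin.Properties using (any?)
open import Data.Fin.Subset using (Subset; _∈_; _⊂_; ∣_∣)
open import Data.Fin.Subset.Properties using (_∈?_)
open import Data.Fin.Subset.Induction using (⊂-wellFounded)
open import Data.Product using (_,_; _×_; ∃-syntax)
open import Data.Sum using (_⊎_; inj₁; inj₂)
open import Data.Vec using ([]; _∷_; tabulate; lookup)
open import Data.Vec.Properties using ([]=⇒lookup; lookup⇒[]=; lookup∘tabulate)
open import Data.Vec.Functional using (Vector; tail)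
open import Function using (_∘_; _on_)
open import Induction.WellFounded using (Acc; acc)
import Relation.Binary.Construct.On as On
open import Relation.Binary.PropositionalEquality
open import Relation.Nullary using (yes; no; contradiction; ¬?; _×-dec_)
open import Algebra.Properties.Semiring.Sum +-*-semiring
  using (sum; sum-cong-≗; sum-replicate-zero; ∑-distrib-+; ∑-comm; *-distribˡ-sum; *-distribʳ-sum)
open import Algebra.Properties.CommutativeSemigroup *-commutativeSemigroup using (interchange)

private
  variable
    m k : ℕ

finSum≡sum : (f : Vector ℕ m) → finSum f ≡ sum f
finSum≡sum {zero}  f = refl
finSum≡sum {suc m} f = cong (f zero +_) (finSum≡sum (tail f))

sum-mono-≤ : {f g : Vector ℕ m} → (∀ i → f i ≤ g i) → sum f ≤ sum g
sum-mono-≤ {zero}  f≤g = z≤n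
sum-mono-≤ {suc m} f≤g = +-mono-≤ (f≤g zero) (sum-mono-≤ (f≤g ∘ suc))

sum*sum : (f : Vector ℕ m) (g : Vector ℕ k) →
          sum f * sum g ≡ sum (λ i → sum (λ j → f i * g j))
sum*sum f g = trans (*-distribʳ-sum (sum g) f) (sum-cong-≗ (λ i → *-distribˡ-sum (f i) g))

2*[m*n]≤m*m+n*n : ∀ m n → 2 * (m * n) ≤ m * m + n * n
2*[m*n]≤m*m+n*n zero    n       = z≤n
2*[m*n]≤m*m+n*n (suc m) zero    rewrite *-zeroʳ m = z≤n
2*[m*n]≤m*m+n*n (suc m) (suc n) =
  subst₂ _≤_ (lhs m n) (rhs m n) (+-monoˡ-≤ (2 * (m + n) + 2) (2*[m*n]≤m*m+n*n m n))
  where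
  lhs : ∀ m n → 2 * (m * n) + (2 * (m + n) + 2) ≡ 2 * ((1 + m) * (1 + n))
  lhs = solve-∀
  rhs : ∀ m n → m * m + n * n + (2 * (m + n) + 2) ≡ (1 + m) * (1 + m) + (1 + n) * (1 + n)
  rhs = solve-∀

sum-transpose-product≤sum-square : (x : Fin m → Fin m → ℕ) →
  sum (λ i → sum (λ j → x i j * x j i)) ≤ sum (λ i → sum (λ j → x i j * x i j))
sum-transpose-product≤sum-square x = *-cancelˡ-≤ 2 (begin
  2 * sum (λ i → sum (λ j → x i j * x j i))
    ≡⟨ *-distribˡ-sum 2 (λ i → sum (λ j → x i j * x j i)) ⟩
  sum (λ i → 2 * sum (λ j → x i j * x j i))
    ≡⟨ sum-cong-≗ (λ i → *-distribˡ-sum 2 (λ j → x i j * x j i)) ⟩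
  sum (λ i → sum (λ j → 2 * (x i j * x j i)))
    ≤⟨ sum-mono-≤ (λ i → sum-mono-≤ (λ j → 2*[m*n]≤m*m+n*n (x i j) (x j i))) ⟩
  sum (λ i → sum (λ j → x i j * x i j + x j i * x j i))
    ≡⟨ sum-cong-≗ (λ i → ∑-distrib-+ (λ j → x i j * x i j) (λ j → x j i * x j i)) ⟩
  sum (λ i → sum (λ j → x i j * x i j) + sum (λ j → x j i * x j i))
    ≡⟨ ∑-distrib-+ (λ i → sum (λ j → x i j * x i j)) (λ i → sum (λ j → x j i * x j i)) ⟩
  S + sum (λ i → sum (λ j → x j i * x j i))
    ≡⟨ cong (S +_) (∑-comm (λ i j → x j i * x j i)) ⟩
  S + S
    ≡⟨ cong (S +_) (+-identityʳ S) ⟨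
  2 * S ∎)
  where
  open ≤-Reasoning
  S = sum (λ i → sum (λ j → x i j * x i j))

⟨_,_⟩ : Vector ℕ m → Vector ℕ m → ℕ
⟨ p , q ⟩ = sum (λ i → p i * q i)

infixl 6 _+ᵛ_
infixl 7 _*ᵛ_

_+ᵛ_ : Vector ℕ m → Vector ℕ m → Vector ℕ m
(p +ᵛ q) i = p i + q i

_*ᵛ_ : ℕ → Vector ℕ m → Vector ℕ m
(c *ᵛ p) i = c * p i

basis : Fin m → Vector ℕ m
basis zero    zero    = 1
basis zero    (suc j) = 0
basis (suc i) zero    = 0
basis (suc i) (suc j) = basis i j

basis-diag : (u : Fin m) → basis u u ≡ 1
basis-diag zero    = refl
basis-diag (suc u) = basis-diag u

basis-off : {u v : Fin m} → u ≢ v → basis u v ≡ 0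
basis-off {u = zero}  {zero}  u≢v = contradiction refl u≢v
basis-off {u = zero}  {suc v} u≢v = refl
basis-off {u = suc u} {zero}  u≢v = refl
basis-off {u = suc u} {suc v} u≢v = basis-off (u≢v ∘ cong suc)

⟨⟩-cong : (p p′ q q′ : Vector ℕ m) → p ≗ p′ → q ≗ q′ → ⟨ p , q ⟩ ≡ ⟨ p′ , q′ ⟩
⟨⟩-cong _ _ _ _ p≗p′ q≗q′ = sum-cong-≗ (λ i → cong₂ _*_ (p≗p′ i) (q≗q′ i))

⟨⟩-congʳ : (p : Vector ℕ m) {q q′ : Vector ℕ m} → q ≗ q′ → ⟨ p , q ⟩ ≡ ⟨ p , q′ ⟩
⟨⟩-congʳ p {q} {q′} = ⟨⟩-cong p p q q′ (λ _ → refl)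

⟨⟩-comm : (p q : Vector ℕ m) → ⟨ p , q ⟩ ≡ ⟨ q , p ⟩
⟨⟩-comm p q = sum-cong-≗ (λ i → *-comm (p i) (q i))

⟨⟩-distribʳ-+ : (p q r : Vector ℕ m) → ⟨ p +ᵛ q , r ⟩ ≡ ⟨ p , r ⟩ + ⟨ q , r ⟩
⟨⟩-distribʳ-+ p q r =
  trans (sum-cong-≗ (λ i → *-distribʳ-+ (r i) (p i) (q i)))
        (∑-distrib-+ (λ i → p i * r i) (λ i → q i * r i))

⟨⟩-distribˡ-+ : (r p q : Vector ℕ m) → ⟨ r , p +ᵛ q ⟩ ≡ ⟨ r , p ⟩ + ⟨ r , q ⟩
⟨⟩-distribˡ-+ r p q =
  trans (sum-cong-≗ (λ i → *-distribˡ-+ (r i) (p i) (q i)))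
        (∑-distrib-+ (λ i → r i * p i) (λ i → r i * q i))

⟨⟩-*ˡ : (c : ℕ) (p q : Vector ℕ m) → ⟨ c *ᵛ p , q ⟩ ≡ c * ⟨ p , q ⟩
⟨⟩-*ˡ c p q =
  trans (sum-cong-≗ (λ i → *-assoc c (p i) (q i))) (sym (*-distribˡ-sum c (λ i → p i * q i)))

⟨⟩-*ʳ : (c : ℕ) (p q : Vector ℕ m) → ⟨ p , c *ᵛ q ⟩ ≡ c * ⟨ p , q ⟩
⟨⟩-*ʳ c p q = trans (⟨⟩-comm p (c *ᵛ q)) (trans (⟨⟩-*ˡ c q p) (cong (c *_) (⟨⟩-comm q p)))

⟨basis,⟩ : (u : Fin m) (p : Vector ℕ m) → ⟨ basis u , p ⟩ ≡ p u
⟨basis,⟩ {suc m} zero    p =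
  trans (cong₂ _+_ (*-identityˡ (p zero)) (sum-replicate-zero m)) (+-identityʳ (p zero))
⟨basis,⟩ {suc m} (suc u) p = ⟨basis,⟩ u (tail p)

⟨,basis⟩ : (u : Fin m) (p : Vector ℕ m) → ⟨ p , basis u ⟩ ≡ p u
⟨,basis⟩ u p = trans (⟨⟩-comm p (basis u)) (⟨basis,⟩ u p)

⟨⟩-monoˡ-≤ : (q : Vector ℕ m) {p p′ : Vector ℕ m} → (∀ i → p i ≤ p′ i) → ⟨ p , q ⟩ ≤ ⟨ p′ , q ⟩
⟨⟩-monoˡ-≤ q p≤p′ = sum-mono-≤ (λ i → *-monoˡ-≤ (q i) (p≤p′ i))

⟨⟩-monoʳ-≤ : (p : Vector ℕ m) {q q′ : Vector ℕ m} → (∀ i → q i ≤ q′ i) → ⟨ p , q ⟩ ≤ ⟨ p , q′ ⟩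
⟨⟩-monoʳ-≤ p q≤q′ = sum-mono-≤ (λ i → *-monoʳ-≤ (p i) (q≤q′ i))

⟨p,1⟩≡sum : (p : Vector ℕ m) → ⟨ p , (λ _ → 1) ⟩ ≡ sum p
⟨p,1⟩≡sum p = sum-cong-≗ (λ i → *-identityʳ (p i))

cauchy-schwarz : (p q : Vector ℕ m) → ⟨ p , q ⟩ * ⟨ p , q ⟩ ≤ ⟨ p , p ⟩ * ⟨ q , q ⟩
cauchy-schwarz p q = begin
  ⟨ p , q ⟩ * ⟨ p , q ⟩
    ≡⟨ sum*sum pq pq ⟩
  sum (λ i → sum (λ j → (p i * q i) * (p j * q j)))
    ≡⟨ sum-cong-≗ (λ i → sum-cong-≗ (λ j → regroup (p i) (q i) (p j) (q j))) ⟩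
  sum (λ i → sum (λ j → (p i * q j) * (p j * q i)))
    ≤⟨ sum-transpose-product≤sum-square (λ i j → p i * q j) ⟩
  sum (λ i → sum (λ j → (p i * q j) * (p i * q j)))
    ≡⟨ sum-cong-≗ (λ i → sum-cong-≗ (λ j → interchange (p i) (q j) (p i) (q j))) ⟩
  sum (λ i → sum (λ j → (p i * p i) * (q j * q j)))
    ≡⟨ sum*sum (λ i → p i * p i) (λ j → q j * q j) ⟨
  ⟨ p , p ⟩ * ⟨ q , q ⟩ ∎
  where
  open ≤-Reasoning
  pq = λ i → p i * q i
  regroup : ∀ a b c d → (a * b) * (c * d) ≡ (a * d) * (c * b)
  regroup = solve-∀

sum-basis : (u : Fin m) → sum (basis u) ≡ 1
sum-basis u = trans (sym (⟨p,1⟩≡sum (basis u))) (⟨basis,⟩ u (λ _ → 1))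

sum-+basis : (p : Vector ℕ m) (c : ℕ) (u : Fin m) → sum (p +ᵛ c *ᵛ basis u) ≡ sum p + c
sum-+basis p c u = begin
  sum (p +ᵛ c *ᵛ basis u)           ≡⟨ ∑-distrib-+ p (c *ᵛ basis u) ⟩
  sum p + sum (c *ᵛ basis u)        ≡⟨ cong (sum p +_) (*-distribˡ-sum c (basis u)) ⟨
  sum p + c * sum (basis u)         ≡⟨ cong (λ t → sum p + c * t) (sum-basis u) ⟩
  sum p + c * 1                     ≡⟨ cong (sum p +_) (*-identityʳ c) ⟩
  sum p + c                         ∎
  where open ≡-Reasoning

𝟙 : Bool → ℕ
𝟙 b = if b then 1 else 0

∣p∣≡sum-𝟙 : (p : Subset m) → ∣ p ∣ ≡ sum (λ i → 𝟙 (lookup p i))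
∣p∣≡sum-𝟙 []          = refl
∣p∣≡sum-𝟙 (true  ∷ p) = cong suc (∣p∣≡sum-𝟙 p)
∣p∣≡sum-𝟙 (false ∷ p) = ∣p∣≡sum-𝟙 p

support : Vector ℕ m → Subset m
support x = tabulate (λ i → 0 <ᵇ x i)

lookup-support : (x : Vector ℕ m) (i : Fin m) → lookup (support x) i ≡ (0 <ᵇ x i)
lookup-support x = lookup∘tabulate (λ i → 0 <ᵇ x i)

∈-support⇒≢0 : (x : Vector ℕ m) {i : Fin m} → i ∈ support x → x i ≢ 0
∈-support⇒≢0 x {i} i∈x = positive (trans (sym (lookup-support x i)) ([]=⇒lookup i∈x))
  where
  positive : ∀ {k} → (0 <ᵇ k) ≡ true → k ≢ 0
  positive {suc k} _ ()

≢0⇒∈-support : (x : Vector ℕ m) {i : Fin m} → x i ≢ 0 → i ∈ support x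
≢0⇒∈-support x {i} xi≢0 = lookup⇒[]= i (support x) (trans (lookup-support x i) (positive xi≢0))
  where
  positive : ∀ {k} → k ≢ 0 → (0 <ᵇ k) ≡ true
  positive {zero}  k≢0 = contradiction refl k≢0
  positive {suc k} _   = refl

sum²≤∣support∣*⟨x,x⟩ : (x : Vector ℕ m) → sum x * sum x ≤ ∣ support x ∣ * ⟨ x , x ⟩
sum²≤∣support∣*⟨x,x⟩ x = begin
  sum x * sum x          ≡⟨ cong₂ _*_ ⟨χ,x⟩≡sum ⟨χ,x⟩≡sum ⟨
  ⟨ χ , x ⟩ * ⟨ χ , x ⟩  ≤⟨ cauchy-schwarz χ x ⟩
  ⟨ χ , χ ⟩ * ⟨ x , x ⟩  ≡⟨ cong (_* ⟨ x , x ⟩) ⟨χ,χ⟩≡∣support∣ ⟩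
  ∣ support x ∣ * ⟨ x , x ⟩ ∎
  where
  open ≤-Reasoning
  χ : Vector ℕ _
  χ i = 𝟙 (lookup (support x) i)
  ⟨χ,x⟩≡sum : ⟨ χ , x ⟩ ≡ sum x
  ⟨χ,x⟩≡sum = sum-cong-≗ (λ i → trans (cong (λ b → 𝟙 b * x i) (lookup-support x i)) (𝟙[0<ᵇk]*k≡k (x i)))
    where
    𝟙[0<ᵇk]*k≡k : ∀ k → 𝟙 (0 <ᵇ k) * k ≡ k
    𝟙[0<ᵇk]*k≡k zero    = refl
    𝟙[0<ᵇk]*k≡k (suc k) = +-identityʳ (suc k)
  ⟨χ,χ⟩≡∣support∣ : ⟨ χ , χ ⟩ ≡ ∣ support x ∣
  ⟨χ,χ⟩≡∣support∣ = trans (sum-cong-≗ (λ i → 𝟙b*𝟙b≡𝟙b (lookup (support x) i))) (sym (∣p∣≡sum-𝟙 (support x)))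
    where
    𝟙b*𝟙b≡𝟙b : ∀ b → 𝟙 b * 𝟙 b ≡ 𝟙 b
    𝟙b*𝟙b≡𝟙b true  = refl
    𝟙b*𝟙b≡𝟙b false = refl

merge : Vector ℕ m → Fin m → Fin m → Vector ℕ m
merge x u v i with i ≟ u | i ≟ v
... | yes _ | _     = x u + x v
... | no _  | yes _ = 0
... | no _  | no _  = x i

module _ {x : Vector ℕ m} {u v : Fin m} (u≢v : u ≢ v) where

  merge-+basis : merge x u v +ᵛ x v *ᵛ basis v ≗ x +ᵛ x v *ᵛ basis u
  merge-+basis i with i ≟ u | i ≟ v
  ... | yes refl | _
    rewrite basis-off (u≢v ∘ sym) | basis-diag u = at-u (x u) (x v)
    where
    at-u : ∀ a b → a + b + b * 0 ≡ a + b * 1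
    at-u = solve-∀
  ... | no _ | yes refl
    rewrite basis-off u≢v | basis-diag v = at-v (x v)
    where
    at-v : ∀ b → 0 + b * 1 ≡ b + b * 0
    at-v = solve-∀
  ... | no i≢u | no i≢v
    rewrite basis-off (i≢v ∘ sym) | basis-off (i≢u ∘ sym) = refl

  merge-at-v : merge x u v v ≡ 0
  merge-at-v with v ≟ u | v ≟ v
  ... | yes v≡u | _      = contradiction (sym v≡u) u≢v
  ... | no _    | yes _  = refl
  ... | no _    | no v≢v = contradiction refl v≢v

  sum-merge : sum (merge x u v) ≡ sum x
  sum-merge = +-cancelʳ-≡ (x v) _ _ (begin
    sum (merge x u v) + x v                   ≡⟨ sum-+basis (merge x u v) (x v) v ⟨
    sum (merge x u v +ᵛ x v *ᵛ basis v)       ≡⟨ sum-cong-≗ merge-+basis ⟩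
    sum (x +ᵛ x v *ᵛ basis u)                 ≡⟨ sum-+basis x (x v) u ⟩
    sum x + x v                               ∎)
    where open ≡-Reasoning

  merge-≢0 : {i : Fin m} → x u ≢ 0 → merge x u v i ≢ 0 → x i ≢ 0
  merge-≢0 {i} xu≢0 yi≢0 with i ≟ u | i ≟ v
  ... | yes refl | _     = xu≢0
  ... | no _     | yes _ = contradiction refl yi≢0
  ... | no _     | no _  = yi≢0

  support-merge⊂ : u ∈ support x → v ∈ support x → support (merge x u v) ⊂ support x
  support-merge⊂ u∈x v∈x =
    (λ i∈y → ≢0⇒∈-support x (merge-≢0 (∈-support⇒≢0 x u∈x) (∈-support⇒≢0 (merge x u v) i∈y))) ,
    v , v∈x , (λ v∈y → ∈-support⇒≢0 (merge x u v) v∈y merge-at-v)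

module _ (G : Graph) where

  adjacency : Fin (n G) → Fin (n G) → ℕ
  adjacency u v = 𝟙 (adj G u v)

  neighbourSum : Vector ℕ (n G) → Vector ℕ (n G)
  neighbourSum x v = ⟨ adjacency v , x ⟩

  quadraticForm : Vector ℕ (n G) → ℕ
  quadraticForm x = ⟨ x , neighbourSum x ⟩

  adjacency-irrefl : (v : Fin (n G)) → adjacency v v ≡ 0
  adjacency-irrefl v = cong 𝟙 (irrefl G v)

  neighbourSum-cong : {p q : Vector ℕ (n G)} → p ≗ q → neighbourSum p ≗ neighbourSum q
  neighbourSum-cong p≗q v = ⟨⟩-congʳ (adjacency v) p≗q

  neighbourSum-+basis : (x : Vector ℕ (n G)) (c : ℕ) (u v : Fin (n G)) →
    neighbourSum (x +ᵛ c *ᵛ basis u) v ≡ neighbourSum x v + c * adjacency v u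
  neighbourSum-+basis x c u v = begin
    ⟨ adjacency v , x +ᵛ c *ᵛ basis u ⟩                ≡⟨ ⟨⟩-distribˡ-+ (adjacency v) x (c *ᵛ basis u) ⟩
    neighbourSum x v + ⟨ adjacency v , c *ᵛ basis u ⟩  ≡⟨ cong (neighbourSum x v +_) (⟨⟩-*ʳ c (adjacency v) (basis u)) ⟩
    neighbourSum x v + c * ⟨ adjacency v , basis u ⟩   ≡⟨ cong (λ t → neighbourSum x v + c * t) (⟨,basis⟩ u (adjacency v)) ⟩
    neighbourSum x v + c * adjacency v u               ∎
    where open ≡-Reasoning

  neighbourSum-selfAdjoint : (p q : Vector ℕ (n G)) → ⟨ p , neighbourSum q ⟩ ≡ ⟨ neighbourSum p , q ⟩
  neighbourSum-selfAdjoint p q = begin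
    sum (λ v → p v * sum (λ u → adjacency v u * q u))
      ≡⟨ sum-cong-≗ (λ v → *-distribˡ-sum (p v) (λ u → adjacency v u * q u)) ⟩
    sum (λ v → sum (λ u → p v * (adjacency v u * q u)))
      ≡⟨ ∑-comm (λ v u → p v * (adjacency v u * q u)) ⟩
    sum (λ u → sum (λ v → p v * (adjacency v u * q u)))
      ≡⟨ sum-cong-≗ (λ u → sum-cong-≗ (λ v → transpose u v)) ⟩
    sum (λ u → sum (λ v → adjacency u v * p v * q u))
      ≡⟨ sum-cong-≗ (λ u → *-distribʳ-sum (q u) (λ v → adjacency u v * p v)) ⟨
    sum (λ u → sum (λ v → adjacency u v * p v) * q u) ∎
    where
    open ≡-Reasoning
    transpose : ∀ u v → p v * (adjacency v u * q u) ≡ adjacency u v * p v * q u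
    transpose u v rewrite Graph.sym G v u = reorder (p v) (adjacency u v) (q u)
      where
      reorder : ∀ a b c → a * (b * c) ≡ b * a * c
      reorder = solve-∀

  quadraticForm-cong : {p q : Vector ℕ (n G)} → p ≗ q → quadraticForm p ≡ quadraticForm q
  quadraticForm-cong {p} {q} p≗q = ⟨⟩-cong p q (neighbourSum p) (neighbourSum q) p≗q (neighbourSum-cong p≗q)

  quadraticForm-+ : (p q : Vector ℕ (n G)) →
    quadraticForm (p +ᵛ q) ≡ quadraticForm p + 2 * ⟨ q , neighbourSum p ⟩ + quadraticForm q
  quadraticForm-+ p q = begin
    ⟨ p +ᵛ q , neighbourSum (p +ᵛ q) ⟩
      ≡⟨ ⟨⟩-congʳ (p +ᵛ q) (λ v → ⟨⟩-distribˡ-+ (adjacency v) p q) ⟩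
    ⟨ p +ᵛ q , neighbourSum p +ᵛ neighbourSum q ⟩
      ≡⟨ ⟨⟩-distribʳ-+ p q (neighbourSum p +ᵛ neighbourSum q) ⟩
    ⟨ p , neighbourSum p +ᵛ neighbourSum q ⟩ + ⟨ q , neighbourSum p +ᵛ neighbourSum q ⟩
      ≡⟨ cong₂ _+_ (⟨⟩-distribˡ-+ p (neighbourSum p) (neighbourSum q))
                   (⟨⟩-distribˡ-+ q (neighbourSum p) (neighbourSum q)) ⟩
    (quadraticForm p + ⟨ p , neighbourSum q ⟩) + (⟨ q , neighbourSum p ⟩ + quadraticForm q)
      ≡⟨ cong (λ t → (quadraticForm p + t) + (⟨ q , neighbourSum p ⟩ + quadraticForm q)) cross ⟩
    (quadraticForm p + ⟨ q , neighbourSum p ⟩) + (⟨ q , neighbourSum p ⟩ + quadraticForm q)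
      ≡⟨ collect (quadraticForm p) ⟨ q , neighbourSum p ⟩ (quadraticForm q) ⟩
    quadraticForm p + 2 * ⟨ q , neighbourSum p ⟩ + quadraticForm q ∎
    where
    open ≡-Reasoning
    cross : ⟨ p , neighbourSum q ⟩ ≡ ⟨ q , neighbourSum p ⟩
    cross = trans (neighbourSum-selfAdjoint p q) (⟨⟩-comm (neighbourSum p) q)
    collect : ∀ a b c → (a + b) + (b + c) ≡ a + 2 * b + c
    collect = solve-∀

  quadraticForm-+basis : (x : Vector ℕ (n G)) (c : ℕ) (u : Fin (n G)) →
    quadraticForm (x +ᵛ c *ᵛ basis u) ≡ quadraticForm x + 2 * (c * neighbourSum x u)
  quadraticForm-+basis x c u = begin
    quadraticForm (x +ᵛ c *ᵛ basis u)
      ≡⟨ quadraticForm-+ x (c *ᵛ basis u) ⟩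
    quadraticForm x + 2 * ⟨ c *ᵛ basis u , neighbourSum x ⟩ + quadraticForm (c *ᵛ basis u)
      ≡⟨ cong₂ (λ s t → quadraticForm x + 2 * s + t) linear-term quadratic-term ⟩
    quadraticForm x + 2 * (c * neighbourSum x u) + 0
      ≡⟨ +-identityʳ _ ⟩
    quadraticForm x + 2 * (c * neighbourSum x u) ∎
    where
    open ≡-Reasoning
    linear-term : ⟨ c *ᵛ basis u , neighbourSum x ⟩ ≡ c * neighbourSum x u
    linear-term = trans (⟨⟩-*ˡ c (basis u) (neighbourSum x)) (cong (c *_) (⟨basis,⟩ u (neighbourSum x)))
    quadratic-term : quadraticForm (c *ᵛ basis u) ≡ 0
    quadratic-term = begin
      ⟨ c *ᵛ basis u , neighbourSum (c *ᵛ basis u) ⟩  ≡⟨ ⟨⟩-*ˡ c (basis u) (neighbourSum (c *ᵛ basis u)) ⟩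
      c * ⟨ basis u , neighbourSum (c *ᵛ basis u) ⟩  ≡⟨ cong (c *_) (⟨basis,⟩ u (neighbourSum (c *ᵛ basis u))) ⟩
      c * ⟨ adjacency u , c *ᵛ basis u ⟩              ≡⟨ cong (c *_) (⟨⟩-*ʳ c (adjacency u) (basis u)) ⟩
      c * (c * ⟨ adjacency u , basis u ⟩)             ≡⟨ cong (λ t → c * (c * t)) (⟨,basis⟩ u (adjacency u)) ⟩
      c * (c * adjacency u u)                         ≡⟨ cong (λ t → c * (c * t)) (adjacency-irrefl u) ⟩
      c * (c * 0)                                     ≡⟨ cong (c *_) (*-zeroʳ c) ⟩
      c * 0                                           ≡⟨ *-zeroʳ c ⟩
      0                                               ∎

  quadraticForm-≤-merge : (x : Vector ℕ (n G)) {u v : Fin (n G)} → u ≢ v → adj G u v ≡ false →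
    neighbourSum x v ≤ neighbourSum x u → quadraticForm x ≤ quadraticForm (merge x u v)
  -- Expanding both sides of merge-+basis gives quadraticForm y + 2 b (neighbourSum y v) =
  -- quadraticForm x + 2 b (neighbourSum x u), and neighbourSum y v = neighbourSum x v because
  -- v is adjacent neither to u nor to itself.
  quadraticForm-≤-merge x {u} {v} u≢v uv∉E xv≤xu = +-cancelʳ-≤ (2 * (b * neighbourSum x v)) _ _ (begin
    quadraticForm x + 2 * (b * neighbourSum x v)   ≤⟨ +-monoʳ-≤ (quadraticForm x) (*-monoʳ-≤ 2 (*-monoʳ-≤ b xv≤xu)) ⟩
    quadraticForm x + 2 * (b * neighbourSum x u)   ≡⟨ quadraticForm-+basis x b u ⟨
    quadraticForm (x +ᵛ b *ᵛ basis u)              ≡⟨ quadraticForm-cong (merge-+basis u≢v) ⟨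
    quadraticForm (y +ᵛ b *ᵛ basis v)              ≡⟨ quadraticForm-+basis y b v ⟩
    quadraticForm y + 2 * (b * neighbourSum y v)   ≡⟨ cong (λ t → quadraticForm y + 2 * (b * t)) yv≡xv ⟩
    quadraticForm y + 2 * (b * neighbourSum x v)   ∎)
    where
    open ≤-Reasoning
    y = merge x u v
    b = x v
    yv≡xv : neighbourSum y v ≡ neighbourSum x v
    yv≡xv = +-cancelʳ-≡ (b * 0) _ _ (begin-equality
      neighbourSum y v + b * 0                     ≡⟨ cong (λ t → neighbourSum y v + b * t) (adjacency-irrefl v) ⟨
      neighbourSum y v + b * adjacency v v         ≡⟨ neighbourSum-+basis y b v v ⟨
      neighbourSum (y +ᵛ b *ᵛ basis v) v           ≡⟨ neighbourSum-cong (merge-+basis u≢v) v ⟩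
      neighbourSum (x +ᵛ b *ᵛ basis u) v           ≡⟨ neighbourSum-+basis x b u v ⟩
      neighbourSum x v + b * adjacency v u         ≡⟨ cong (λ t → neighbourSum x v + b * 𝟙 t) (trans (Graph.sym G v u) uv∉E) ⟩
      neighbourSum x v + b * 0                     ∎)

  nonEdge-shift : (x : Vector ℕ (n G)) {u v : Fin (n G)} →
    u ∈ support x → v ∈ support x → u ≢ v → adj G u v ≡ false →
    ∃[ y ] support y ⊂ support x × sum y ≡ sum x × quadraticForm x ≤ quadraticForm y
  nonEdge-shift x {u} {v} u∈x v∈x u≢v uv∉E with ≤-total (neighbourSum x v) (neighbourSum x u)
  ... | inj₁ xv≤xu =
    merge x u v , support-merge⊂ {x = x} u≢v u∈x v∈x , sum-merge {x = x} u≢v , quadraticForm-≤-merge x u≢v uv∉E xv≤xu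
  ... | inj₂ xu≤xv =
    merge x v u , support-merge⊂ {x = x} v≢u v∈x u∈x , sum-merge {x = x} v≢u , quadraticForm-≤-merge x v≢u vu∉E xu≤xv
    where
    v≢u = u≢v ∘ sym
    vu∉E = trans (Graph.sym G v u) uv∉E

  neighbourSum+self≤sum : (x : Vector ℕ (n G)) (v : Fin (n G)) → neighbourSum x v + x v ≤ sum x
  neighbourSum+self≤sum x v = begin
    ⟨ adjacency v , x ⟩ + x v               ≡⟨ cong (⟨ adjacency v , x ⟩ +_) (⟨basis,⟩ v x) ⟨
    ⟨ adjacency v , x ⟩ + ⟨ basis v , x ⟩   ≡⟨ ⟨⟩-distribʳ-+ (adjacency v) (basis v) x ⟨
    ⟨ adjacency v +ᵛ basis v , x ⟩          ≤⟨ ⟨⟩-monoˡ-≤ x adjacency+basis≤1 ⟩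
    ⟨ (λ _ → 1) , x ⟩                       ≡⟨ sum-cong-≗ (λ u → *-identityˡ (x u)) ⟩
    sum x                                   ∎
    where
    open ≤-Reasoning
    adjacency+basis≤1 : ∀ u → adjacency v u + basis v u ≤ 1
    adjacency+basis≤1 u with v ≟ u
    ... | yes refl rewrite adjacency-irrefl v | basis-diag v = ≤-refl
    ... | no v≢u rewrite basis-off v≢u with adj G v u
    ...   | true  = ≤-refl
    ...   | false = z≤n

  quadraticForm+⟨x,x⟩≤sum² : (x : Vector ℕ (n G)) → quadraticForm x + ⟨ x , x ⟩ ≤ sum x * sum x
  quadraticForm+⟨x,x⟩≤sum² x = begin
    ⟨ x , neighbourSum x ⟩ + ⟨ x , x ⟩   ≡⟨ ⟨⟩-distribˡ-+ x (neighbourSum x) x ⟨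
    ⟨ x , neighbourSum x +ᵛ x ⟩          ≤⟨ ⟨⟩-monoʳ-≤ x (neighbourSum+self≤sum x) ⟩
    ⟨ x , (λ _ → sum x) ⟩                ≡⟨ *-distribʳ-sum (sum x) x ⟨
    sum x * sum x                        ∎
    where open ≤-Reasoning

  quadraticForm-bound-by-support : (ω : ℕ) (x : Vector ℕ (n G)) → ∣ support x ∣ ≤ ω →
    ω * quadraticForm x ≤ (ω ∸ 1) * (sum x * sum x)
  quadraticForm-bound-by-support ω x ∣x∣≤ω = begin
    ω * q            ≤⟨ m+n≤o⇒m≤o∸n (ω * q) ωq+s≤ωs ⟩
    ω * s ∸ s        ≡⟨ cong (ω * s ∸_) (*-identityˡ s) ⟨
    ω * s ∸ 1 * s    ≡⟨ *-distribʳ-∸ s ω 1 ⟨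
    (ω ∸ 1) * s      ∎
    where
    open ≤-Reasoning
    q = quadraticForm x
    r = ⟨ x , x ⟩
    s = sum x * sum x
    ωq+s≤ωs : ω * q + s ≤ ω * s
    ωq+s≤ωs = begin
      ω * q + s        ≤⟨ +-monoʳ-≤ (ω * q) (≤-trans (sum²≤∣support∣*⟨x,x⟩ x) (*-monoˡ-≤ r ∣x∣≤ω)) ⟩
      ω * q + ω * r    ≡⟨ *-distribˡ-+ ω q r ⟨
      ω * (q + r)      ≤⟨ *-monoʳ-≤ ω (quadraticForm+⟨x,x⟩≤sum² x) ⟩
      ω * s            ∎

  clique⊎nonEdge : (S : Subset (n G)) →
    IsClique G S ⊎ ∃[ u ] ∃[ v ] u ∈ S × v ∈ S × u ≢ v × adj G u v ≡ false
  clique⊎nonEdge S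
    with any? (λ u → any? (λ v → u ∈? S ×-dec v ∈? S ×-dec ¬? (u ≟ v) ×-dec adj G u v Bool.≟ false))
  ... | yes nonEdge  = inj₂ nonEdge
  ... | no noNonEdge = inj₁ clique
    where
    clique : IsClique G S
    clique u v u∈S v∈S u≢v with adj G u v in uv
    ... | true  = refl
    ... | false = contradiction (u , v , u∈S , v∈S , u≢v , uv) noNonEdge

  motzkin-straus : (ω : ℕ) → (∀ S → IsClique G S → ∣ S ∣ ≤ ω) →
    (x : Vector ℕ (n G)) → ω * quadraticForm x ≤ (ω ∸ 1) * (sum x * sum x)
  motzkin-straus ω cliques≤ω x = go x (On.wellFounded support ⊂-wellFounded x)
    where
    go : (x : Vector ℕ (n G)) → Acc (_⊂_ on support) x →
         ω * quadraticForm x ≤ (ω ∸ 1) * (sum x * sum x)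
    go x (acc smaller) with clique⊎nonEdge (support x)
    ... | inj₁ clique = quadraticForm-bound-by-support ω x (cliques≤ω (support x) clique)
    ... | inj₂ (u , v , u∈x , v∈x , u≢v , uv∉E) with nonEdge-shift x u∈x v∈x u≢v uv∉E
    ...   | y , y⊂x , Σy≡Σx , Qx≤Qy = begin
      ω * quadraticForm x         ≤⟨ *-monoʳ-≤ ω Qx≤Qy ⟩
      ω * quadraticForm y         ≤⟨ go y (smaller y⊂x) ⟩
      (ω ∸ 1) * (sum y * sum y)   ≡⟨ cong (λ t → (ω ∸ 1) * (t * t)) Σy≡Σx ⟩
      (ω ∸ 1) * (sum x * sum x)   ∎
      where open ≤-Reasoning

  walks : ℕ → Vector ℕ (n G)
  walks k = walksEnd G (suc k)

  walks-suc : (k : ℕ) → walks (suc k) ≗ neighbourSum (walks k)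
  walks-suc k v = trans (finSum≡sum (λ u → if adj G u v then walks k u else 0)) (sum-cong-≗ step)
    where
    step : ∀ u → (if adj G u v then walks k u else 0) ≡ adjacency v u * walks k u
    step u rewrite Graph.sym G u v with adj G v u
    ... | true  = sym (+-identityʳ (walks k u))
    ... | false = refl

  walks-+ : (i j : ℕ) → ⟨ walks (i + j) , walks 0 ⟩ ≡ ⟨ walks i , walks j ⟩
  walks-+ i zero    = cong (λ k → ⟨ walks k , walks 0 ⟩) (+-identityʳ i)
  walks-+ i (suc j) = begin
    ⟨ walks (i + suc j) , walks 0 ⟩         ≡⟨ cong (λ k → ⟨ walks k , walks 0 ⟩) (+-suc i j) ⟩
    ⟨ walks (suc i + j) , walks 0 ⟩         ≡⟨ walks-+ (suc i) j ⟩
    ⟨ walks (suc i) , walks j ⟩             ≡⟨ ⟨⟩-cong _ _ (walks j) (walks j) (walks-suc i) (λ _ → refl) ⟩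
    ⟨ neighbourSum (walks i) , walks j ⟩    ≡⟨ neighbourSum-selfAdjoint (walks i) (walks j) ⟨
    ⟨ walks i , neighbourSum (walks j) ⟩    ≡⟨ ⟨⟩-congʳ (walks i) (walks-suc j) ⟨
    ⟨ walks i , walks (suc j) ⟩             ∎
    where open ≡-Reasoning

  w-suc≡sum-walks : (k : ℕ) → w (suc k) G ≡ sum (walks k)
  w-suc≡sum-walks k = finSum≡sum (walks k)

  w-even≡quadraticForm : (k : ℕ) → w (2 * suc k) G ≡ quadraticForm (walks k)
  w-even≡quadraticForm k = begin
    -- 2 * suc k reduces to suc (k + (suc k + 0))
    w (2 * suc k) G                           ≡⟨ w-suc≡sum-walks (k + (suc k + 0)) ⟩
    sum (walks (k + (suc k + 0)))             ≡⟨ ⟨p,1⟩≡sum (walks (k + (suc k + 0))) ⟨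
    ⟨ walks (k + (suc k + 0)) , walks 0 ⟩     ≡⟨ walks-+ k (suc k + 0) ⟩
    ⟨ walks k , walks (suc k + 0) ⟩           ≡⟨ cong (λ j → ⟨ walks k , walks j ⟩) (+-identityʳ (suc k)) ⟩
    ⟨ walks k , walks (suc k) ⟩               ≡⟨ ⟨⟩-congʳ (walks k) (walks-suc k) ⟩
    quadraticForm (walks k)                   ∎
    where open ≡-Reasoning

mainTheorem6 : (r : ℕ) → r > 0 → (G : Graph) → (ω : ℕ) → IsCliqueNumber G ω →
    ω * w (2 * r) G ≤ (ω ∸ 1) * (w r G ^ 2)
mainTheorem6 (suc k) _ G ω (_ , cliques≤ω) = begin
  ω * w (2 * suc k) G                    ≡⟨ cong (ω *_) (w-even≡quadraticForm G k) ⟩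
  ω * quadraticForm G (walks G k)        ≤⟨ motzkin-straus G ω cliques≤ω (walks G k) ⟩
  (ω ∸ 1) * (sum (walks G k) * sum (walks G k))
                                         ≡⟨ cong (λ t → (ω ∸ 1) * (t * t)) (w-suc≡sum-walks G k) ⟨
  (ω ∸ 1) * (w (suc k) G * w (suc k) G)  ≡⟨ cong (λ t → (ω ∸ 1) * (w (suc k) G * t)) (*-identityʳ _) ⟨
  (ω ∸ 1) * (w (suc k) G ^ 2)            ∎
  where open ≤-Reasoning
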